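{- Let $\mathcal{H}$ be a (possibly infinite) set of sequents with empty antecedents and $\Pi\to B$ a sequent, all in the product-free language. Then: (1) if $\Pi\to B$ is derivable from $\mathcal{H}$ in $\mathbf{L}^{\Lambda}\wedge\mathbf{0}\mathbf{1}$, then there exists a finite $\mathcal{H}'\subseteq\mathcal{H}$ such that the sequent ${!}\mathcal{H}',\Pi\to B$ is derivable in ${!}\mathbf{L}^{\Lambda}\wedge\mathbf{0}\mathbf{1}$; (2) if, for a finite $\mathcal{H}'\subseteq\mathcal{H}$, the sequent ${!}\mathcal{H}',\Pi\to B$ is derivable in ${!}\mathbf{L}^{\Lambda}\wedge\mathbf{0}\mathbf{1}$, then $\Pi\to B$ is derivable from $\mathcal{H}'$ (and hence from $\mathcal{H}$) in $\mathbf{L}^{\Lambda}_{\backslash,/}\wedge\mathbf{0}\mathbf{1}$; (3) moreover, if $\mathcal{H}$ and $\Pi\to B$ contain no occurrences of $\mathbf{0}$ and $\mathbf{1}$, then the conclusion of (2) holds with $\mathbf{L}^{\Lambda}_{\backslash,/}\wedge$ in place of $\mathbf{L}^{\Lambda}_{\backslash,/}\wedge\mathbf{0}\mathbf{1}$.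
   Context: Formulae are built from a countable set of propositional variables and the constants $\mathbf{0}$ and $\mathbf{1}$ using the binary connectives $\cdot$, $\backslash$, $/$, $\wedge$; the product-free language omits $\cdot$. A sequent is $\Pi \to B$ with $B$ a formula and $\Pi$ a finite, possibly empty, sequence of formulae (empty sequence written $\Lambda$). The calculus $\mathbf{L}^{\Lambda}\wedge\mathbf{0}\mathbf{1}$ has the axioms $A \to A$, $\Gamma,\mathbf{0},\Delta \to C$ and $\Lambda \to \mathbf{1}$, and rules (capital Greek letters denote possibly empty sequences): (Cut) from $\Pi \to A$ and $\Gamma, A, \Delta \to C$ infer $\Gamma,\Pi,\Delta\to C$; ($\backslash L$) from $\Pi\to A$ and $\Gamma,B,\Delta\to C$ infer $\Gamma,\Pi,A\backslash B,\Delta\to C$; ($\backslash R$) from $A,\Pi\to B$ infer $\Pi\to A\backslash B$; ($/ L$) from $\Pi\to A$ and $\Gamma,B,\Delta\to C$ infer $\Gamma,B/A,\Pi,\Delta\to C$; ($/R$) from $\Pi,A\to B$ infer $\Pi\to B/A$; ($\cdot L$) from $\Gamma,A,B,\Delta\to C$ infer $\Gamma,A\cdot B,\Delta\to C$; ($\cdot R$) from $\Pi\to A$ and $\Delta\to B$ infer $\Pi,\Delta\to A\cdot B$; ($\wedge L$) from $\Gamma,A,\Delta\to C$ infer both $\Gamma,A\wedge B,\Delta\to C$ and $\Gamma,B\wedge A,\Delta\to C$; ($\wedge R$) from $\Pi\to A$ and $\Pi\to B$ infer $\Pi\to A\wedge B$; ($\mathbf{1} L$) from $\Gamma,\Delta\to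 C$ infer $\Gamma,\mathbf{1},\Delta\to C$. $\mathbf{L}^{\Lambda}_{\backslash,/}\wedge\mathbf{0}\mathbf{1}$ is obtained by removing $\cdot L$, $\cdot R$ (product-free language); $\mathbf{L}^{\Lambda}_{\backslash,/}\wedge$ is obtained by further removing the axioms $\Gamma,\mathbf{0},\Delta\to C$, $\Lambda\to\mathbf{1}$ and rule $\mathbf{1}L$ (language of $\backslash,/,\wedge$). A sequent is derivable from a set of sequents $\mathcal H$ if it is derivable when the sequents of $\mathcal H$ are added as extra axioms. The calculus ${!}\mathbf{L}^{\Lambda}\wedge\mathbf{0}\mathbf{1}$ extends the language with a unary connective ${!}$ and extends $\mathbf{L}^{\Lambda}\wedge\mathbf{0}\mathbf{1}$ with the rules: (${!}L$) from $\Gamma,A,\Delta\to C$ infer $\Gamma,{!}A,\Delta\to C$; (${!}R$) from ${!}A_1,\ldots,{!}A_n\to B$ infer ${!}A_1,\ldots,{!}A_n\to{!}B$; (${!}W$) from $\Gamma,\Delta\to C$ infer $\Gamma,{!}A,\Delta\to C$; (${!}P_1$) from $\Gamma,\Phi,{!}A,\Delta\to C$ infer $\Gamma,{!}A,\Phi,\Delta\to C$; (${!}P_2$) from $\Gamma,{!}A,\Phi,\Delta\to C$ infer $\Gamma,\Phi,{!}A,\Delta\to C$; (${!}C$) from $\Gamma,{!}A,{!}A,\Delta\to C$ infer $\Gamma,{!}A,\Delta\to C$. For a finite set $\mathcal{H}'=\{\Lambda\to A_1,\ldots,\Lambda\to A_n\}$ of sequents with empty antecedents, ${!}\mathcal{H}'$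 denotes the sequence ${!}A_1,\ldots,{!}A_n$ (in any order). -}

module Defs where

open import Data.Nat using (ℕ)
open import Data.Bool using (Bool; true; false; T)
open import Data.Unit using (⊤)
open import Data.Product using (_×_)
open import Data.List using (List; []; _∷_; _++_; map)
open import Data.List.Relation.Unary.All using (All)

-- Formulae over countably many variables (indexed by ℕ).
-- One datatype for all languages; languages are carved out by InLang.
data Fm : Set where
  var  : ℕ → Fm
  𝟘 𝟙  : Fm
  _·_  : Fm → Fm → Fm
  _⧵_  : Fm → Fm → Fm   -- A ⧵ B  is  A \ B
  _╱_  : Fm → Fm → Fm   -- B ╱ A  is  B / A
  _∧_  : Fm → Fm → Fm
  !_   : Fm → Fm

record Lang : Set where
  constructor lang
  field
    prod  : Bool
    const : Bool
    bang  : Bool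
open Lang public

InLang : Lang → Fm → Set
InLang ℓ (var _) = ⊤
InLang ℓ 𝟘 = T (const ℓ)
InLang ℓ 𝟙 = T (const ℓ)
InLang ℓ (A · B) = T (prod ℓ) × InLang ℓ A × InLang ℓ B
InLang ℓ (A ⧵ B) = InLang ℓ A × InLang ℓ B
InLang ℓ (A ╱ B) = InLang ℓ A × InLang ℓ B
InLang ℓ (A ∧ B) = InLang ℓ A × InLang ℓ B
InLang ℓ (! A) = T (bang ℓ) × InLang ℓ A

-- Derivability of Π → C from hypotheses H (a set of sequents Λ → A, given as
-- a predicate on A) in the calculus over language ℓ. The rules for ·, 0, 1, !
-- are available only when the language has the connective; the cut formula must
-- lie in the language (all other formulae of the premises occur in the conclusion).
data Der (ℓ : Lang) (H : Fm → Set) : List Fm → Fm → Set where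
  ax   : ∀ {A} → Der ℓ H (A ∷ []) A
  hyp  : ∀ {A} → H A → Der ℓ H [] A
  0L   : ∀ {Γ Δ C} → T (const ℓ) → Der ℓ H (Γ ++ 𝟘 ∷ Δ) C
  1R   : T (const ℓ) → Der ℓ H [] 𝟙
  cut  : ∀ {Π Γ Δ A C} → InLang ℓ A →
         Der ℓ H Π A → Der ℓ H (Γ ++ A ∷ Δ) C → Der ℓ H (Γ ++ Π ++ Δ) C
  ⧵L   : ∀ {Π Γ Δ A B C} →
         Der ℓ H Π A → Der ℓ H (Γ ++ B ∷ Δ) C → Der ℓ H (Γ ++ Π ++ (A ⧵ B) ∷ Δ) C
  ⧵R   : ∀ {Π A B} → Der ℓ H (A ∷ Π) B → Der ℓ H Π (A ⧵ B)
  ╱L   : ∀ {Π Γ Δ A B C} →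
         Der ℓ H Π A → Der ℓ H (Γ ++ B ∷ Δ) C → Der ℓ H (Γ ++ (B ╱ A) ∷ Π ++ Δ) C
  ╱R   : ∀ {Π A B} → Der ℓ H (Π ++ A ∷ []) B → Der ℓ H Π (B ╱ A)
  ·L   : ∀ {Γ Δ A B C} → T (prod ℓ) →
         Der ℓ H (Γ ++ A ∷ B ∷ Δ) C → Der ℓ H (Γ ++ (A · B) ∷ Δ) C
  ·R   : ∀ {Π Δ A B} → T (prod ℓ) →
         Der ℓ H Π A → Der ℓ H Δ B → Der ℓ H (Π ++ Δ) (A · B)
  ∧L₁  : ∀ {Γ Δ A B C} → Der ℓ H (Γ ++ A ∷ Δ) C → Der ℓ H (Γ ++ (A ∧ B) ∷ Δ) C
  ∧L₂  : ∀ {Γ Δ A B C} → Der ℓ H (Γ ++ A ∷ Δ) C → Der ℓ H (Γ ++ (B ∧ A) ∷ Δ) C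
  ∧R   : ∀ {Π A B} → Der ℓ H Π A → Der ℓ H Π B → Der ℓ H Π (A ∧ B)
  1L   : ∀ {Γ Δ C} → T (const ℓ) → Der ℓ H (Γ ++ Δ) C → Der ℓ H (Γ ++ 𝟙 ∷ Δ) C
  !L   : ∀ {Γ Δ A C} → T (bang ℓ) →
         Der ℓ H (Γ ++ A ∷ Δ) C → Der ℓ H (Γ ++ (! A) ∷ Δ) C
  !R   : ∀ {As B} → T (bang ℓ) →
         Der ℓ H (map !_ As) B → Der ℓ H (map !_ As) (! B)
  !W   : ∀ {Γ Δ A C} → T (bang ℓ) →
         Der ℓ H (Γ ++ Δ) C → Der ℓ H (Γ ++ (! A) ∷ Δ) C
  !P₁  : ∀ {Γ Φ Δ A C} → T (bang ℓ) →
         Der ℓ H (Γ ++ Φ ++ (! A) ∷ Δ) C → Der ℓ H (Γ ++ (! A) ∷ Φ ++ Δ) C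
  !P₂  : ∀ {Γ Φ Δ A C} → T (bang ℓ) →
         Der ℓ H (Γ ++ (! A) ∷ Φ ++ Δ) C → Der ℓ H (Γ ++ Φ ++ (! A) ∷ Δ) C
  !C   : ∀ {Γ Δ A C} → T (bang ℓ) →
         Der ℓ H (Γ ++ (! A) ∷ (! A) ∷ Δ) C → Der ℓ H (Γ ++ (! A) ∷ Δ) C

L∧01 : Lang
L∧01 = lang true true false
!L∧01 : Lang
!L∧01 = lang true true true
L⧵╱∧01 : Lang
L⧵╱∧01 = lang false true false
L⧵╱∧ : Lang
L⧵╱∧ = lang false false false

∅ : Fm → Set
∅ _ = Data.Empty.⊥
  where import Data.Empty

ProdFree : Fm → Set
ProdFree = InLang L⧵╱∧01

NoConst : Fm → Set
NoConst = InLang L⧵╱∧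

{-# OPTIONS --safe #-}
-- (1) By induction on derivations: a use of a hypothesis Λ → A becomes the axiom-like
-- !A → A (rule !L), and the !-formulae collected from the premises are moved to the front
-- of the antecedent with !P₁/!P₂ and, for the two premises of ∧R, added by !W.
--
-- (2), (3) Semantically, avoiding cut elimination. Interpret formulae of the !-calculus
-- as sets of antecedents in the canonical model of the target calculus with hypotheses
-- H′: cl S is the set of Γ that may replace every σ ∈ S in any derivable sequent
-- Δ₁, σ, Δ₂ → D, and ⟦ ! A ⟧ is the closure of {Λ} when Λ ∈ ⟦ A ⟧. Every interpretation is
-- cl-closed, which makes the !-calculus sound. On formulae of the target language,
-- Γ ∈ ⟦ C ⟧ holds exactly when Γ → C is derivable (this uses the cut rule of the target),
-- so each hypothesis A of H′ has Λ ∈ ⟦ A ⟧, and then !H′, Π is realised by Π itself.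
module Submission where

open import Defs
open import Data.Bool using (T)
open import Data.Empty using (⊥; ⊥-elim)
open import Data.Unit using (tt)
open import Data.Product using (Σ; _×_; _,_; proj₁; proj₂)
open import Data.List using (List; []; _∷_; _++_; map)
open import Data.List.Properties using (++-monoid; ++-assoc; ++-identityʳ; map-++)
open import Data.List.Relation.Unary.All as All using (All; []; _∷_; lookup; tabulate)
open import Data.List.Relation.Unary.All.Properties using (++⁺)
open import Data.List.Membership.Propositional using (_∈_)
open import Relation.Binary.PropositionalEquality using (_≡_; refl; sym; trans; cong; subst)
open import Relation.Nullary using (¬_)
open import Algebra.Solver.Monoid (++-monoid Fm) using (solve; _⊕_; _⊜_)

cast : ∀ {ℓ H S S′ C} → S ≡ S′ → Der ℓ H S C → Der ℓ H S′ C
cast refl d = d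

rule-after : ∀ {ℓ H} P Γ {X Y C D} →
  (Der ℓ H ((P ++ Γ) ++ X) C → Der ℓ H ((P ++ Γ) ++ Y) D) →
  Der ℓ H (P ++ Γ ++ X) C → Der ℓ H (P ++ Γ ++ Y) D
rule-after P Γ {X} {Y} rule d = cast (++-assoc P Γ Y) (rule (cast (sym (++-assoc P Γ X)) d))

Der-mono-hyp : ∀ {ℓ H H′ S C} → (∀ {A} → H A → H′ A) → Der ℓ H S C → Der ℓ H′ S C
Der-mono-hyp f ax          = ax
Der-mono-hyp f (hyp h)     = hyp (f h)
Der-mono-hyp f (0L c)      = 0L c
Der-mono-hyp f (1R c)      = 1R c
Der-mono-hyp f (cut i d e) = cut i (Der-mono-hyp f d) (Der-mono-hyp f e)
Der-mono-hyp f (⧵L d e)    = ⧵L (Der-mono-hyp f d) (Der-mono-hyp f e)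
Der-mono-hyp f (⧵R d)      = ⧵R (Der-mono-hyp f d)
Der-mono-hyp f (╱L d e)    = ╱L (Der-mono-hyp f d) (Der-mono-hyp f e)
Der-mono-hyp f (╱R d)      = ╱R (Der-mono-hyp f d)
Der-mono-hyp f (·L p d)    = ·L p (Der-mono-hyp f d)
Der-mono-hyp f (·R p d e)  = ·R p (Der-mono-hyp f d) (Der-mono-hyp f e)
Der-mono-hyp f (∧L₁ d)     = ∧L₁ (Der-mono-hyp f d)
Der-mono-hyp f (∧L₂ d)     = ∧L₂ (Der-mono-hyp f d)
Der-mono-hyp f (∧R d e)    = ∧R (Der-mono-hyp f d) (Der-mono-hyp f e)
Der-mono-hyp f (1L c d)    = 1L c (Der-mono-hyp f d)
Der-mono-hyp f (!L b d)    = !L b (Der-mono-hyp f d)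
Der-mono-hyp f (!R b d)    = !R b (Der-mono-hyp f d)
Der-mono-hyp f (!W b d)    = !W b (Der-mono-hyp f d)
Der-mono-hyp f (!P₁ b d)   = !P₁ b (Der-mono-hyp f d)
Der-mono-hyp f (!P₂ b d)   = !P₂ b (Der-mono-hyp f d)
Der-mono-hyp f (!C b d)    = !C b (Der-mono-hyp f d)

!s : List Fm → List Fm
!s = map !_

!s-++ : ∀ K₁ K₂ X → !s K₁ ++ !s K₂ ++ X ≡ !s (K₁ ++ K₂) ++ X
!s-++ K₁ K₂ X = trans (sym (++-assoc (!s K₁) (!s K₂) X)) (cong (_++ X) (sym (map-++ !_ K₁ K₂)))

module BangStructural {ℓ : Lang} {H : Fm → Set} (b : T (bang ℓ)) where

  weaken-!s : ∀ Γ K Δ {C} → Der ℓ H (Γ ++ Δ) C → Der ℓ H (Γ ++ !s K ++ Δ) C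
  weaken-!s Γ []      Δ d = d
  weaken-!s Γ (A ∷ K) Δ d = !W {Γ = Γ} {Δ = !s K ++ Δ} b (weaken-!s Γ K Δ d)

  pull-!s : ∀ Γ Φ K Δ {C} → Der ℓ H (Γ ++ Φ ++ !s K ++ Δ) C → Der ℓ H (Γ ++ !s K ++ Φ ++ Δ) C
  pull-!s Γ Φ []      Δ d = d
  pull-!s Γ Φ (A ∷ K) Δ d =
    cast (++-assoc Γ (! A ∷ []) _)
      (pull-!s (Γ ++ ! A ∷ []) Φ K Δ
        (cast (sym (++-assoc Γ (! A ∷ []) _)) (!P₁ {Γ = Γ} {Φ = Φ} {Δ = !s K ++ Δ} b d)))

  push-!s : ∀ Γ Φ K Δ {C} → Der ℓ H (Γ ++ !s K ++ Φ ++ Δ) C → Der ℓ H (Γ ++ Φ ++ !s K ++ Δ) C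
  push-!s Γ Φ []      Δ d = d
  push-!s Γ Φ (A ∷ K) Δ d =
    !P₂ {Γ = Γ} {Φ = Φ} {Δ = !s K ++ Δ} b
      (cast (++-assoc Γ (! A ∷ []) _)
        (push-!s (Γ ++ ! A ∷ []) Φ K Δ (cast (sym (++-assoc Γ (! A ∷ []) _)) d)))

  merge-!s : ∀ K₁ K₂ Γ Φ Π Δ {C} →
    Der ℓ H ((!s K₂ ++ Γ) ++ Φ ++ (!s K₁ ++ Π) ++ Δ) C →
    Der ℓ H (!s (K₁ ++ K₂) ++ Γ ++ Φ ++ Π ++ Δ) C
  merge-!s K₁ K₂ Γ Φ Π Δ d =
    cast (trans (cong (!s K₁ ++_) (solve 5 (λ k Γ Φ Π Δ → (k ⊕ Γ ⊕ Φ) ⊕ Π ⊕ Δ ⊜ k ⊕ Γ ⊕ Φ ⊕ Π ⊕ Δ)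
                                     refl (!s K₂) Γ Φ Π Δ))
                (!s-++ K₁ K₂ (Γ ++ Φ ++ Π ++ Δ)))
      (pull-!s [] (!s K₂ ++ Γ ++ Φ) K₁ (Π ++ Δ)
        (cast (solve 6 (λ k₂ Γ Φ k₁ Π Δ → (k₂ ⊕ Γ) ⊕ Φ ⊕ (k₁ ⊕ Π) ⊕ Δ ⊜ (k₂ ⊕ Γ ⊕ Φ) ⊕ k₁ ⊕ Π ⊕ Δ)
                 refl (!s K₂) Γ Φ (!s K₁) Π Δ) d))

InLang-!L∧01 : ∀ {ℓ} → ¬ T (bang ℓ) → ∀ A → InLang ℓ A → InLang !L∧01 A
InLang-!L∧01 nb (var x) i = i
InLang-!L∧01 nb 𝟘 i = tt
InLang-!L∧01 nb 𝟙 i = tt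
InLang-!L∧01 nb (A · B) (_ , a , b) = tt , InLang-!L∧01 nb A a , InLang-!L∧01 nb B b
InLang-!L∧01 nb (A ⧵ B) (a , b) = InLang-!L∧01 nb A a , InLang-!L∧01 nb B b
InLang-!L∧01 nb (A ╱ B) (a , b) = InLang-!L∧01 nb A a , InLang-!L∧01 nb B b
InLang-!L∧01 nb (A ∧ B) (a , b) = InLang-!L∧01 nb A a , InLang-!L∧01 nb B b
InLang-!L∧01 nb (! A) (b , _) = ⊥-elim (nb b)

open BangStructural {ℓ = !L∧01} {H = ∅} tt

!Der : (Fm → Set) → List Fm → Fm → Set
!Der H S C = Σ (List Fm) λ K → All H K × Der !L∧01 ∅ (!s K ++ S) C

!Der-map : ∀ {H S S′ C C′} →
  (∀ K → Der !L∧01 ∅ (!s K ++ S) C → Der !L∧01 ∅ (!s K ++ S′) C′) → !Der H S C → !Der H S′ C′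
!Der-map f (K , h , d) = K , h , f K d

!Der-map₂ : ∀ {H S₁ S₂ S C₁ C₂ C} →
  (∀ K₁ K₂ → Der !L∧01 ∅ (!s K₁ ++ S₁) C₁ → Der !L∧01 ∅ (!s K₂ ++ S₂) C₂ →
             Der !L∧01 ∅ (!s (K₁ ++ K₂) ++ S) C) →
  !Der H S₁ C₁ → !Der H S₂ C₂ → !Der H S C
!Der-map₂ f (K₁ , h₁ , d) (K₂ , h₂ , e) = K₁ ++ K₂ , ++⁺ h₁ h₂ , f K₁ K₂ d e

!-deduction : ∀ {ℓ H S C} → ¬ T (bang ℓ) → Der ℓ H S C → !Der H S C
!-deduction nb ax = [] , [] , ax
!-deduction nb (hyp {A} h) = A ∷ [] , h ∷ [] , !L {Γ = []} {Δ = []} tt ax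
!-deduction nb (0L {Γ} {Δ} _) = [] , [] , 0L {Γ = Γ} {Δ = Δ} tt
!-deduction nb (1R _) = [] , [] , 1R tt
!-deduction nb (cut {Π} {Γ} {Δ} {A} i d e) = !Der-map₂
  (λ K₁ K₂ d′ e′ → merge-!s K₁ K₂ Γ [] Π Δ
    (cut (InLang-!L∧01 nb A i) d′ (cast (sym (++-assoc (!s K₂) Γ _)) e′)))
  (!-deduction nb d) (!-deduction nb e)
!-deduction nb (⧵L {Π} {Γ} {Δ} {A} {B} d e) = !Der-map₂
  (λ K₁ K₂ d′ e′ → merge-!s K₁ K₂ Γ [] Π (A ⧵ B ∷ Δ) (⧵L d′ (cast (sym (++-assoc (!s K₂) Γ _)) e′)))
  (!-deduction nb d) (!-deduction nb e)
!-deduction nb (╱L {Π} {Γ} {Δ} {A} {B} d e) = !Der-map₂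
  (λ K₁ K₂ d′ e′ → merge-!s K₁ K₂ Γ (B ╱ A ∷ []) Π Δ (╱L d′ (cast (sym (++-assoc (!s K₂) Γ _)) e′)))
  (!-deduction nb d) (!-deduction nb e)
!-deduction nb (⧵R {Π} {A} d) =
  !Der-map (λ K d′ → ⧵R (push-!s [] (A ∷ []) K Π d′)) (!-deduction nb d)
!-deduction nb (╱R {Π} {A} d) =
  !Der-map (λ K d′ → ╱R (cast (sym (++-assoc (!s K) Π (A ∷ []))) d′)) (!-deduction nb d)
!-deduction nb (·L {Γ} _ d) = !Der-map (λ K → rule-after (!s K) Γ (·L tt)) (!-deduction nb d)
!-deduction nb (·R {Π} {Δ} _ d e) = !Der-map₂
  (λ K₁ K₂ d′ e′ → cast (!s-++ K₁ K₂ (Π ++ Δ))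
    (pull-!s (!s K₁) Π K₂ Δ (cast (++-assoc (!s K₁) Π (!s K₂ ++ Δ)) (·R tt d′ e′))))
  (!-deduction nb d) (!-deduction nb e)
!-deduction nb (∧L₁ {Γ} d) = !Der-map (λ K → rule-after (!s K) Γ ∧L₁) (!-deduction nb d)
!-deduction nb (∧L₂ {Γ} d) = !Der-map (λ K → rule-after (!s K) Γ ∧L₂) (!-deduction nb d)
!-deduction nb (∧R {Π} d e) = !Der-map₂
  (λ K₁ K₂ d′ e′ → cast (!s-++ K₁ K₂ Π)
    (∧R (weaken-!s (!s K₁) K₂ Π d′) (weaken-!s [] K₁ (!s K₂ ++ Π) e′)))
  (!-deduction nb d) (!-deduction nb e)
!-deduction nb (1L {Γ} _ d) = !Der-map (λ K → rule-after (!s K) Γ (1L tt)) (!-deduction nb d)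
!-deduction nb (!L b _)  = ⊥-elim (nb b)
!-deduction nb (!R b _)  = ⊥-elim (nb b)
!-deduction nb (!W b _)  = ⊥-elim (nb b)
!-deduction nb (!P₁ b _) = ⊥-elim (nb b)
!-deduction nb (!P₂ b _) = ⊥-elim (nb b)
!-deduction nb (!C b _)  = ⊥-elim (nb b)

module CanonicalModel (ℓ : Lang) (G : Fm → Set) where

  Ctxs : Set₁
  Ctxs = List Fm → Set

  cl : Ctxs → Ctxs
  cl S Γ = ∀ Δ₁ Δ₂ D → (∀ σ → S σ → Der ℓ G (Δ₁ ++ σ ++ Δ₂) D) → Der ℓ G (Δ₁ ++ Γ ++ Δ₂) D

  Closed : Ctxs → Set
  Closed X = ∀ Γ → cl X Γ → X Γ

  cl-unit : ∀ {S : Ctxs} {Γ} → S Γ → cl S Γ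
  cl-unit s Δ₁ Δ₂ D h = h _ s

  cl-mono : ∀ {S T : Ctxs} {Γ} → (∀ {σ} → S σ → T σ) → cl S Γ → cl T Γ
  cl-mono f c Δ₁ Δ₂ D h = c Δ₁ Δ₂ D (λ σ s → h σ (f s))

  cl-closed : ∀ {S : Ctxs} → Closed (cl S)
  cl-closed Γ c Δ₁ Δ₂ D h = c Δ₁ Δ₂ D (λ σ s → s Δ₁ Δ₂ D h)

  cl-elim : ∀ {S X : Ctxs} → Closed X → ∀ Γ x Δ → cl S x →
    (∀ σ → S σ → X (Γ ++ σ ++ Δ)) → X (Γ ++ x ++ Δ)
  cl-elim {X = X} cX Γ x Δ c f = cX _ λ Δ₁ Δ₂ D h →
    cast (sym (regroup Δ₁ x Δ₂)) (c (Δ₁ ++ Γ) (Δ ++ Δ₂) D (λ σ s → cast (regroup Δ₁ σ Δ₂) (h _ (f σ s))))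
    where
    regroup : ∀ Δ₁ σ Δ₂ → Δ₁ ++ (Γ ++ σ ++ Δ) ++ Δ₂ ≡ (Δ₁ ++ Γ) ++ σ ++ Δ ++ Δ₂
    regroup Δ₁ σ Δ₂ = solve 5 (λ Δ₁ Γ σ Δ Δ₂ → Δ₁ ⊕ (Γ ⊕ σ ⊕ Δ) ⊕ Δ₂ ⊜ (Δ₁ ⊕ Γ) ⊕ σ ⊕ Δ ⊕ Δ₂)
                        refl Δ₁ Γ σ Δ Δ₂

  ⟦_⟧ : Fm → Ctxs
  ⟦ var n ⟧ Γ = Der ℓ G Γ (var n)
  ⟦ 𝟘 ⟧ = cl (λ _ → ⊥)
  ⟦ 𝟙 ⟧ = cl (_≡ [])
  ⟦ A · B ⟧ = cl (λ σ → Σ (List Fm) λ a → Σ (List Fm) λ b → ⟦ A ⟧ a × ⟦ B ⟧ b × σ ≡ a ++ b)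
  ⟦ A ⧵ B ⟧ Γ = ∀ a → ⟦ A ⟧ a → ⟦ B ⟧ (a ++ Γ)
  ⟦ B ╱ A ⟧ Γ = ∀ a → ⟦ A ⟧ a → ⟦ B ⟧ (Γ ++ a)
  ⟦ A ∧ B ⟧ Γ = ⟦ A ⟧ Γ × ⟦ B ⟧ Γ
  ⟦ ! A ⟧ = cl (λ σ → σ ≡ [] × ⟦ A ⟧ [])

  ⟦⟧-closed : ∀ A → Closed ⟦ A ⟧
  ⟦⟧-closed (var n) Γ c =
    cast (++-identityʳ Γ) (c [] [] (var n) (λ σ s → cast (sym (++-identityʳ σ)) s))
  ⟦⟧-closed 𝟘 = cl-closed
  ⟦⟧-closed 𝟙 = cl-closed
  ⟦⟧-closed (A · B) = cl-closed
  ⟦⟧-closed (A ⧵ B) Γ c a x = ⟦⟧-closed B (a ++ Γ) λ Δ₁ Δ₂ D h →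
    cast (sym (regroup Δ₁ Γ Δ₂)) (c (Δ₁ ++ a) Δ₂ D (λ τ t → cast (regroup Δ₁ τ Δ₂) (h (a ++ τ) (t a x))))
    where
    regroup : ∀ Δ₁ τ Δ₂ → Δ₁ ++ (a ++ τ) ++ Δ₂ ≡ (Δ₁ ++ a) ++ τ ++ Δ₂
    regroup Δ₁ τ Δ₂ = solve 4 (λ Δ₁ a τ Δ₂ → Δ₁ ⊕ (a ⊕ τ) ⊕ Δ₂ ⊜ (Δ₁ ⊕ a) ⊕ τ ⊕ Δ₂) refl Δ₁ a τ Δ₂
  ⟦⟧-closed (B ╱ A) Γ c a x = ⟦⟧-closed B (Γ ++ a) λ Δ₁ Δ₂ D h →
    cast (cong (Δ₁ ++_) (sym (++-assoc Γ a Δ₂)))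
      (c Δ₁ (a ++ Δ₂) D (λ τ t → cast (cong (Δ₁ ++_) (++-assoc τ a Δ₂)) (h (τ ++ a) (t a x))))
  ⟦⟧-closed (A ∧ B) Γ c = ⟦⟧-closed A Γ (cl-mono proj₁ c) , ⟦⟧-closed B Γ (cl-mono proj₂ c)
  ⟦⟧-closed (! A) = cl-closed

  data ⟦_⟧⋆ : List Fm → Ctxs where
    []  : ⟦ [] ⟧⋆ []
    _∷_ : ∀ {A a S γ} → ⟦ A ⟧ a → ⟦ S ⟧⋆ γ → ⟦ A ∷ S ⟧⋆ (a ++ γ)

  record Split (S T : List Fm) (γ : List Fm) : Set where
    constructor split
    field
      {γ₁ γ₂} : List Fm
      left    : ⟦ S ⟧⋆ γ₁
      right   : ⟦ T ⟧⋆ γ₂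
      γ≡      : γ ≡ γ₁ ++ γ₂

  ⟦⟧⋆-split : ∀ S {T γ} → ⟦ S ++ T ⟧⋆ γ → Split S T γ
  ⟦⟧⋆-split []      p = split [] p refl
  ⟦⟧⋆-split (A ∷ S) (_∷_ {a = a} x p) with split {γ₁} {γ₂} l r refl ← ⟦⟧⋆-split S p =
    split (x ∷ l) r (sym (++-assoc a γ₁ γ₂))

  ⟦⟧⋆-++ : ∀ {S T γ₁ γ₂} → ⟦ S ⟧⋆ γ₁ → ⟦ T ⟧⋆ γ₂ → ⟦ S ++ T ⟧⋆ (γ₁ ++ γ₂)
  ⟦⟧⋆-++ [] q = q
  ⟦⟧⋆-++ (_∷_ {a = a} {γ = γ} x p) q = subst ⟦ _ ⟧⋆ (sym (++-assoc a γ _)) (x ∷ ⟦⟧⋆-++ p q)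

  ⟦⟧⋆-!s : ∀ As → All (λ A → ⟦ A ⟧ []) As → ⟦ !s As ⟧⋆ []
  ⟦⟧⋆-!s []       []       = []
  ⟦⟧⋆-!s (A ∷ As) (x ∷ xs) = cl-unit (refl , x) ∷ ⟦⟧⋆-!s As xs

  ⟦⟧⋆-!s-elim : ∀ As {γ} {X : Ctxs} → Closed X → ∀ Γ Δ → ⟦ !s As ⟧⋆ γ →
    (All (λ A → ⟦ A ⟧ []) As → X (Γ ++ Δ)) → X (Γ ++ γ ++ Δ)
  ⟦⟧⋆-!s-elim []       cX Γ Δ [] f = f []
  ⟦⟧⋆-!s-elim (A ∷ As) {X = X} cX Γ Δ (_∷_ {a = a} {γ = γ} x p) f =
    subst X (cong (Γ ++_) (sym (++-assoc a γ Δ)))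
      (cl-elim cX Γ a (γ ++ Δ) x λ { σ (refl , y) → ⟦⟧⋆-!s-elim As cX Γ Δ p (λ ys → f (y ∷ ys)) })

  Valid : List Fm → Fm → Set
  Valid S C = ∀ γ → ⟦ S ⟧⋆ γ → ⟦ C ⟧ γ

  valid-!L : ∀ Γ {Δ A C} → Valid (Γ ++ A ∷ Δ) C → Valid (Γ ++ ! A ∷ Δ) C
  valid-!L Γ {A = A} v _ p with split l (x ∷ r) refl ← ⟦⟧⋆-split Γ p =
    v _ (⟦⟧⋆-++ l (⟦⟧-closed A _ (cl-mono (λ { (refl , y) → y }) x) ∷ r))

  valid-!R : ∀ As {B} → Valid (!s As) B → Valid (!s As) (! B)
  valid-!R As {B} v γ p =
    subst ⟦ ! B ⟧ (++-identityʳ γ)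
      (⟦⟧⋆-!s-elim As (⟦⟧-closed (! B)) [] [] p λ ys → cl-unit (refl , v [] (⟦⟧⋆-!s As ys)))

  valid-!W : ∀ Γ {Δ A C} → Valid (Γ ++ Δ) C → Valid (Γ ++ ! A ∷ Δ) C
  valid-!W Γ {C = C} v _ p with split {g} l (_∷_ {γ = t} x r) refl ← ⟦⟧⋆-split Γ p =
    cl-elim (⟦⟧-closed C) g _ t x λ { _ (refl , _) → v _ (⟦⟧⋆-++ l r) }

  valid-!P₁ : ∀ Γ Φ {Δ A C} → Valid (Γ ++ Φ ++ ! A ∷ Δ) C → Valid (Γ ++ ! A ∷ Φ ++ Δ) C
  valid-!P₁ Γ Φ {C = C} v _ p
    with split {g} l (x ∷ r) refl ← ⟦⟧⋆-split Γ p
    with split {f} {t} m r′ refl ← ⟦⟧⋆-split Φ r =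
    cl-elim (⟦⟧-closed C) g _ (f ++ t) x λ { _ (refl , y) →
      v _ (⟦⟧⋆-++ l (⟦⟧⋆-++ m (cl-unit (refl , y) ∷ r′))) }

  valid-!P₂ : ∀ Γ Φ {Δ A C} → Valid (Γ ++ ! A ∷ Φ ++ Δ) C → Valid (Γ ++ Φ ++ ! A ∷ Δ) C
  valid-!P₂ Γ Φ {C = C} v _ p
    with split {g} l r refl ← ⟦⟧⋆-split Γ p
    with split {f} m (_∷_ {a = a} {γ = t} x r′) refl ← ⟦⟧⋆-split Φ r =
    subst ⟦ C ⟧ (++-assoc g f _)
      (cl-elim (⟦⟧-closed C) (g ++ f) a t x λ { _ (refl , y) →
        subst ⟦ C ⟧ (sym (++-assoc g f _)) (v _ (⟦⟧⋆-++ l (cl-unit (refl , y) ∷ ⟦⟧⋆-++ m r′))) })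

  valid-!C : ∀ Γ {Δ A C} → Valid (Γ ++ ! A ∷ ! A ∷ Δ) C → Valid (Γ ++ ! A ∷ Δ) C
  valid-!C Γ {C = C} v _ p with split {g} l (_∷_ {γ = t} x r) refl ← ⟦⟧⋆-split Γ p =
    cl-elim (⟦⟧-closed C) g _ t x λ { _ (refl , y) →
      v _ (⟦⟧⋆-++ l (cl-unit (refl , y) ∷ cl-unit (refl , y) ∷ r)) }

  soundness : ∀ {ℓ′ S C} → Der ℓ′ ∅ S C → Valid S C
  soundness {C = C} ax _ (_∷_ {a = a} x []) = subst ⟦ C ⟧ (sym (++-identityʳ a)) x
  soundness {C = C} (0L {Γ} _) _ p with split {g} l (_∷_ {γ = t} x r) refl ← ⟦⟧⋆-split Γ p =
    cl-elim (⟦⟧-closed C) g _ t x λ _ ()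
  soundness (1R _) _ [] = cl-unit refl
  soundness (cut {Π} {Γ} _ d e) _ p
    with split l r refl ← ⟦⟧⋆-split Γ p
    with split m r′ refl ← ⟦⟧⋆-split Π r =
    soundness e _ (⟦⟧⋆-++ l (soundness d _ m ∷ r′))
  soundness {C = C} (⧵L {Π} {Γ} d e) _ p
    with split {g} l r refl ← ⟦⟧⋆-split Γ p
    with split {q} m (_∷_ {a = f} x r′) refl ← ⟦⟧⋆-split Π r =
    subst ⟦ C ⟧ (cong (g ++_) (++-assoc q f _)) (soundness e _ (⟦⟧⋆-++ l (x q (soundness d q m) ∷ r′)))
  soundness (⧵R d) γ p a x = soundness d (a ++ γ) (x ∷ p)
  soundness {C = C} (╱L {Π} {Γ} d e) _ p
    with split {g} l (_∷_ {a = f} x r) refl ← ⟦⟧⋆-split Γ p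
    with split {q} m r′ refl ← ⟦⟧⋆-split Π r =
    subst ⟦ C ⟧ (cong (g ++_) (++-assoc f q _)) (soundness e _ (⟦⟧⋆-++ l (x q (soundness d q m) ∷ r′)))
  soundness (╱R {B = B} d) γ p a x =
    subst ⟦ B ⟧ (cong (γ ++_) (++-identityʳ a)) (soundness d _ (⟦⟧⋆-++ p (x ∷ [])))
  soundness {C = C} (·L {Γ} _ d) _ p with split {g} l (_∷_ {γ = t} x r) refl ← ⟦⟧⋆-split Γ p =
    cl-elim (⟦⟧-closed C) g _ t x λ { _ (a , b , xa , xb , refl) →
      subst ⟦ C ⟧ (cong (g ++_) (sym (++-assoc a b t))) (soundness d _ (⟦⟧⋆-++ l (xa ∷ xb ∷ r))) }
  soundness (·R {Π} _ d e) _ p with split l r refl ← ⟦⟧⋆-split Π p =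
    cl-unit (_ , _ , soundness d _ l , soundness e _ r , refl)
  soundness (∧L₁ {Γ} d) _ p with split l (x ∷ r) refl ← ⟦⟧⋆-split Γ p =
    soundness d _ (⟦⟧⋆-++ l (proj₁ x ∷ r))
  soundness (∧L₂ {Γ} d) _ p with split l (x ∷ r) refl ← ⟦⟧⋆-split Γ p =
    soundness d _ (⟦⟧⋆-++ l (proj₂ x ∷ r))
  soundness (∧R d e) γ p = soundness d γ p , soundness e γ p
  soundness {C = C} (1L {Γ} _ d) _ p with split {g} l (_∷_ {γ = t} x r) refl ← ⟦⟧⋆-split Γ p =
    cl-elim (⟦⟧-closed C) g _ t x λ { _ refl → soundness d _ (⟦⟧⋆-++ l r) }
  soundness {C = C} (!L {Γ} _ d) = valid-!L Γ {C = C} (soundness d)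
  soundness (!R {As} {B} _ d) = valid-!R As {B} (soundness d)
  soundness {C = C} (!W {Γ} _ d) = valid-!W Γ {C = C} (soundness d)
  soundness {C = C} (!P₁ {Γ} {Φ} _ d) = valid-!P₁ Γ Φ {C = C} (soundness d)
  soundness {C = C} (!P₂ {Γ} {Φ} _ d) = valid-!P₂ Γ Φ {C = C} (soundness d)
  soundness {C = C} (!C {Γ} _ d) = valid-!C Γ {C = C} (soundness d)

  module _ (np : ¬ T (prod ℓ)) (nb : ¬ T (bang ℓ)) where

    reflect : ∀ C → InLang ℓ C → ∀ {Γ} → Der ℓ G Γ C → ⟦ C ⟧ Γ
    reify   : ∀ C → InLang ℓ C → ∀ {Γ} → ⟦ C ⟧ Γ → Der ℓ G Γ C

    reflect (var n) _ d = d
    reflect 𝟘 c {Γ} d Δ₁ Δ₂ D _ = cut {Π = Γ} {Γ = Δ₁} c d (0L {Γ = Δ₁} c)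
    reflect 𝟙 c {Γ} d Δ₁ Δ₂ D h = cut {Π = Γ} {Γ = Δ₁} c d (1L {Γ = Δ₁} c (h [] refl))
    reflect (A · B) (p , _) _ = ⊥-elim (np p)
    reflect (A ⧵ B) i@(iA , iB) {Γ} d a x =
      reflect B iB (cut {Γ = []} iA (reify A iA x)
        (cast (cong (A ∷_) (++-identityʳ Γ)) (cut {Γ = A ∷ []} {Δ = []} i d (⧵L {Γ = []} {Δ = []} ax ax))))
    reflect (B ╱ A) i@(iB , iA) {Γ} d a x =
      reflect B iB (cast (cong (Γ ++_) (++-identityʳ a))
        (cut {Γ = Γ} {Δ = []} iA (reify A iA x) (cut {Γ = []} i d (╱L {Γ = []} {Δ = []} ax ax))))
    reflect (A ∧ B) i@(iA , iB) {Γ} d =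
      reflect A iA (cast (++-identityʳ Γ) (cut {Γ = []} {Δ = []} i d (∧L₁ {Γ = []} {Δ = []} ax))) ,
      reflect B iB (cast (++-identityʳ Γ) (cut {Γ = []} {Δ = []} i d (∧L₂ {Γ = []} {Δ = []} ax)))
    reflect (! A) (b , _) _ = ⊥-elim (nb b)

    reify (var n) _ x = x
    reify 𝟘 _ {Γ} x = cast (++-identityʳ Γ) (x [] [] 𝟘 λ _ ())
    reify 𝟙 c {Γ} x = cast (++-identityʳ Γ) (x [] [] 𝟙 λ { _ refl → 1R c })
    reify (A · B) (p , _) _ = ⊥-elim (np p)
    reify (A ⧵ B) (iA , iB) f = ⧵R (reify B iB (f (A ∷ []) (reflect A iA ax)))
    reify (B ╱ A) (iB , iA) f = ╱R (reify B iB (f (A ∷ []) (reflect A iA ax)))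
    reify (A ∧ B) (iA , iB) (x , y) = ∧R (reify A iA x) (reify B iB y)
    reify (! A) (b , _) _ = ⊥-elim (nb b)

    ⟦⟧⋆-refl : ∀ {Π} → All (InLang ℓ) Π → ⟦ Π ⟧⋆ Π
    ⟦⟧⋆-refl {[]}    []       = []
    ⟦⟧⋆-refl {A ∷ Π} (i ∷ is) = reflect A i ax ∷ ⟦⟧⋆-refl is

    eliminate-! : ∀ {ℓ′ K Π B} → All G K → All (InLang ℓ) K → All (InLang ℓ) Π → InLang ℓ B →
      Der ℓ′ ∅ (!s K ++ Π) B → Der ℓ G Π B
    eliminate-! {K = K} {B = B} hs iK iΠ iB d =
      reify B iB (soundness d _ (⟦⟧⋆-++ (⟦⟧⋆-!s K (All.zipWith (λ (h , i) → reflect _ i (hyp h)) (hs , iK)))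
                                        (⟦⟧⋆-refl iΠ)))

!-conservativity : ∀ {ℓ H Π B} → ¬ T (prod ℓ) → ¬ T (bang ℓ) →
  (∀ A → H A → InLang ℓ A) → All (InLang ℓ) Π → InLang ℓ B →
  ∀ H′ → All H H′ → Der !L∧01 ∅ (!s H′ ++ Π) B →
  Der ℓ (_∈ H′) Π B × Der ℓ H Π B
!-conservativity {ℓ} {Π = Π} {B} np nb iH iΠ iB H′ hs d = d′ , Der-mono-hyp (lookup hs) d′
  where
  d′ : Der ℓ (_∈ H′) Π B
  d′ = CanonicalModel.eliminate-! ℓ (_∈ H′) np nb
         (tabulate λ m → m) (All.map (λ {A} → iH A) hs) iΠ iB d

lemma6p2 : (H : Fm → Set) (Π : List Fm) (B : Fm) →
    (∀ A → H A → ProdFree A) → All ProdFree Π → ProdFree B →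
    ((Der L∧01 H Π B →
        Σ (List Fm) λ H′ → All H H′ × Der !L∧01 ∅ (map !_ H′ ++ Π) B)
    × (∀ (H′ : List Fm) → All H H′ → Der !L∧01 ∅ (map !_ H′ ++ Π) B →
        Der L⧵╱∧01 (λ A → A ∈ H′) Π B × Der L⧵╱∧01 H Π B))
    × ((∀ A → H A → NoConst A) → All NoConst Π → NoConst B →
        ∀ (H′ : List Fm) → All H H′ → Der !L∧01 ∅ (map !_ H′ ++ Π) B →
        Der L⧵╱∧ (λ A → A ∈ H′) Π B × Der L⧵╱∧ H Π B)
lemma6p2 H Π B iH iΠ iB =
  (!-deduction (λ ()) , !-conservativity (λ ()) (λ ()) iH iΠ iB) ,
  !-conservativity (λ ()) (λ ())
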